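{- For every finite graph $G$, $\operatorname{pw}(G)\le \mathcal{L}^m(G)$.
   Context: Lions and contamination game. Let $G=(V,E)$ be a finite graph, $N(v)$ the set of neighbours of $v$. A lion strategy with $k\ge 1$ lions consists of initial positions $p_1(0),\dots,p_k(0)\in V$ and, for each $t\ge 1$, positions $p_i(t)\in\{p_i(t-1)\}\cup N(p_i(t-1))$. Put $L_t=\{p_i(t)\}_i$, $\pi_t=\{(p_i(t-1),p_i(t))\}_i$. Contaminated sets: $W_0=V\setminus L_0$, and for $t\ge1$, $W_t=(W_{t-1}\setminus L_t)\cup\{v\in V\setminus L_t:\exists w\in W_{t-1}\cap N(v)\text{ with }(v,w)\notin\pi_t,(w,v)\notin\pi_t\}$. The strategy clears $G$ if $W_T=\emptyset$ for some $T$. It is monotone if $W_t\subseteq W_{t-1}$ for all $t\ge1$. The monotone lion number $\mathcal{L}^m(G)$ is the minimum number of lions of a monotone strategy clearing $G$. $\operatorname{pw}(G)$ denotes the pathwidth of $G$. -}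

module Defs where

open import Data.Nat using (ℕ; zero; suc; _+_; _≤_)
open import Data.Fin using (Fin; zero; suc; _≟_)
open import Data.Bool using (Bool; true; false; _∧_; _∨_; not; if_then_else_)
open import Data.Product using (Σ; _×_; ∃; _,_)
open import Data.Sum using (_⊎_)
open import Relation.Nullary.Decidable using (⌊_⌋)
open import Relation.Binary.PropositionalEquality using (_≡_)

record Graph : Set where
  field
    n     : ℕ
    adj   : Fin n → Fin n → Bool
    sym   : ∀ u v → adj u v ≡ adj v u
    irrefl : ∀ v → adj v v ≡ false
open Graph public

anyF : {m : ℕ} → (Fin m → Bool) → Bool
anyF {zero}  f = false
anyF {suc m} f = f zero ∨ anyF (λ i → f (suc i))

count : {m : ℕ} → (Fin m → Bool) → ℕ
count {zero}  f = 0
count {suc m} f = (if f zero then 1 else 0) + count (λ i → f (suc i))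

_==_ : {m : ℕ} → Fin m → Fin m → Bool
a == b = ⌊ a ≟ b ⌋

record LionStrategy (G : Graph) (k : ℕ) : Set where
  field
    pos   : ℕ → Fin k → Fin (n G)
    moves : ∀ t i → pos (suc t) i ≡ pos t i ⊎ adj G (pos t i) (pos (suc t) i) ≡ true
open LionStrategy public

module _ {G : Graph} {k : ℕ} (S : LionStrategy G k) where
  inL : ℕ → Fin (n G) → Bool
  inL t v = anyF (λ i → pos S t i == v)

  -- (v , w) ∈ π_{t+1} = {(p_i(t), p_i(t+1))}
  inπ : ℕ → Fin (n G) → Fin (n G) → Bool
  inπ t v w = anyF (λ i → (pos S t i == v) ∧ (pos S (suc t) i == w))

  W : ℕ → Fin (n G) → Bool
  W zero    v = not (inL zero v)
  W (suc t) v = not (inL (suc t) v) ∧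
    (W t v ∨ anyF (λ w → W t w ∧ adj G v w ∧ not (inπ t v w) ∧ not (inπ t w v)))

  Clears : Set
  Clears = ∃ λ T → ∀ v → W T v ≡ false

  Monotone : Set
  Monotone = ∀ t v → W (suc t) v ≡ true → W t v ≡ true

record PathDecomposition (G : Graph) : Set where
  field
    r       : ℕ
    bag     : Fin r → Fin (n G) → Bool
    covV    : ∀ v → ∃ λ i → bag i v ≡ true
    covE    : ∀ u v → adj G u v ≡ true → ∃ λ i → bag i u ≡ true × bag i v ≡ true
    interval : ∀ (i j l : Fin r) v → Data.Fin._≤_ i j → Data.Fin._≤_ j l →
               bag i v ≡ true → bag l v ≡ true → bag j v ≡ true
open PathDecomposition public

WidthAtMost : {G : Graph} → PathDecomposition G → ℕ → Set
WidthAtMost D k = ∀ i → count (bag D i) ≤ suc k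

PathwidthAtMost : Graph → ℕ → Set
PathwidthAtMost G k = Σ (PathDecomposition G) λ D → WidthAtMost D k

{-# OPTIONS --safe #-}
-- Monotonicity gives every vertex a single clearing time. Order the vertices by clearing time
-- (ties by index). Every prefix of this order either lies in the clean set at time 0 or lies
-- between the clean sets at two consecutive times s and s + 1. A prefix vertex with a
-- neighbour outside the prefix (necessarily contaminated at time s) escapes recontamination
-- only if a lion stands on it at time s + 1 or has just moved from it along such an edge;
-- so at most k prefix vertices have outside neighbours. The bags "i-th vertex plus the
-- boundary of the i-th prefix" then form a path decomposition with bags of size at most k + 1.
module Submission where

open import Defs hiding (sym)
open import Data.Nat as ℕ using (ℕ; _≤_; zero; suc; _+_; z≤n; s≤s)
open import Data.Nat.Properties
  using (≤-refl; ≤-reflexive; ≤-trans; <⇒≤; ≤⇒≯; ≰⇒>; ≮⇒≥; m≤n⇒m<n∨m≡n; m≤n⇒m≤1+n; n≤1+n;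
         +-suc; +-monoʳ-≤; +-mono-≤)
open import Data.Fin as F using (Fin; toℕ; combine; _≟_; _<?_)
open import Data.Fin.Properties
  using (suc-injective; toℕ-injective; <-asym; combine-monoˡ-<; combine-injectiveʳ; combine-surjective)
open import Data.Bool using (Bool; true; false; _∧_; _∨_; not; if_then_else_)
open import Data.Bool.Properties using (∨-zeroʳ; ∧-conicalˡ; ∧-conicalʳ; not-injective)
open import Data.Product using (_×_; ∃; _,_; proj₁)
open import Data.Sum using (_⊎_; inj₁; inj₂)
open import Function using (_∘_)
open import Function.Definitions using (Injective)
open import Relation.Nullary using (Dec; yes; no; ¬_; contradiction)
open import Relation.Nullary.Decidable using (⌊_⌋)
open import Relation.Binary.PropositionalEquality using (_≡_; refl; sym; trans; cong; cong₂; subst)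

private
  variable
    A : Set
    m m′ : ℕ

⌊⌋-true : (a? : Dec A) → A → ⌊ a? ⌋ ≡ true
⌊⌋-true (yes _) _ = refl
⌊⌋-true (no ¬a) a = contradiction a ¬a

⌊⌋-true⁻ : (a? : Dec A) → ⌊ a? ⌋ ≡ true → A
⌊⌋-true⁻ (yes a) _ = a

⌊⌋-false : (a? : Dec A) → ¬ A → ⌊ a? ⌋ ≡ false
⌊⌋-false (yes a) ¬a = contradiction a ¬a
⌊⌋-false (no _) _ = refl

⌊⌋-false⁻ : (a? : Dec A) → ⌊ a? ⌋ ≡ false → ¬ A
⌊⌋-false⁻ (no ¬a) _ = ¬a

≡true⇒≢false : {b : Bool} → b ≡ true → ¬ b ≡ false
≡true⇒≢false refl ()

∨⇒⊎ : ∀ a {b} → a ∨ b ≡ true → a ≡ true ⊎ b ≡ true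
∨⇒⊎ true _ = inj₁ refl
∨⇒⊎ false b = inj₂ b

anyF⇒∃ : (f : Fin m → Bool) → anyF f ≡ true → ∃ λ i → f i ≡ true
anyF⇒∃ {suc m} f any with ∨⇒⊎ (f F.zero) any
... | inj₁ f₀ = F.zero , f₀
... | inj₂ rest with i , fi ← anyF⇒∃ (f ∘ F.suc) rest = F.suc i , fi

∃⇒anyF : (f : Fin m → Bool) (i : Fin m) → f i ≡ true → anyF f ≡ true
∃⇒anyF f F.zero f₀ = cong (_∨ anyF (f ∘ F.suc)) f₀
∃⇒anyF f (F.suc i) fi = trans (cong (f F.zero ∨_) (∃⇒anyF (f ∘ F.suc) i fi)) (∨-zeroʳ (f F.zero))

==⇒≡ : {a b : Fin m} → (a == b) ≡ true → a ≡ b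
==⇒≡ {a = a} {b} = ⌊⌋-true⁻ (a ≟ b)

≡⇒== : {a b : Fin m} → a ≡ b → (a == b) ≡ true
≡⇒== {a = a} {b} = ⌊⌋-true (a ≟ b)

count-false : (f : Fin m → Bool) → (∀ x → f x ≡ false) → count f ≡ 0
count-false {zero} f _ = refl
count-false {suc m} f none rewrite none F.zero = count-false (f ∘ F.suc) (none ∘ F.suc)

count-mono : (f g : Fin m → Bool) → (∀ x → f x ≡ true → g x ≡ true) → count f ≤ count g
count-mono {zero} f g _ = z≤n
count-mono {suc m} f g f⊆g
  with f F.zero in f₀ | g F.zero in g₀ | count-mono (f ∘ F.suc) (g ∘ F.suc) (f⊆g ∘ F.suc)
... | true  | true  | ih = s≤s ih
... | true  | false | _  = contradiction g₀ (≡true⇒≢false (f⊆g F.zero f₀))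
... | false | true  | ih = m≤n⇒m≤1+n ih
... | false | false | ih = ih

count-∨ : (f g : Fin m → Bool) → count (λ x → f x ∨ g x) ≤ count f + count g
count-∨ {zero} f g = z≤n
count-∨ {suc m} f g with f F.zero | g F.zero | count-∨ (f ∘ F.suc) (g ∘ F.suc)
... | true  | true  | ih = s≤s (≤-trans ih (+-monoʳ-≤ (count (f ∘ F.suc)) (n≤1+n _)))
... | true  | false | ih = s≤s ih
... | false | true  | ih = ≤-trans (s≤s ih) (≤-reflexive (sym (+-suc (count (f ∘ F.suc)) _)))
... | false | false | ih = ih

count-≤1 : (f : Fin m → Bool) → (∀ {x y} → f x ≡ true → f y ≡ true → x ≡ y) → count f ≤ 1
count-≤1 {zero} f _ = z≤n
count-≤1 {suc m} f unique with f F.zero in f₀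
... | true  = s≤s (≤-reflexive (count-false (f ∘ F.suc) rest))
  where
  rest : ∀ x → f (F.suc x) ≡ false
  rest x with f (F.suc x) in fx
  ... | false = refl
  ... | true with () ← unique f₀ fx
... | false = count-≤1 (f ∘ F.suc) (λ fx fy → suc-injective (unique fx fy))

count-image≤ : (h : Fin m → Fin m′) → count (λ x → anyF (λ i → h i == x)) ≤ m
count-image≤ {zero} {m′} h = ≤-reflexive (count-false {m′} _ λ _ → refl)
count-image≤ {suc m} h =
  ≤-trans (count-∨ (λ x → h F.zero == x) (λ x → anyF (λ i → h (F.suc i) == x)))
    (+-mono-≤ (count-≤1 (h F.zero ==_) λ p q → trans (sym (==⇒≡ p)) (==⇒≡ q))
              (count-image≤ (h ∘ F.suc)))

covered⇒count≤ : (f : Fin m′ → Bool) (h : Fin m → Fin m′) →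
  (∀ x → f x ≡ true → ∃ λ i → h i ≡ x) → count f ≤ m
covered⇒count≤ f h covered = ≤-trans (count-mono f _ hit) (count-image≤ h)
  where
  hit : ∀ x → f x ≡ true → anyF (λ i → h i == x) ≡ true
  hit x fx with i , hi≡x ← covered x fx = ∃⇒anyF _ i (≡⇒== hi≡x)

combine-<⇒≤ˡ : ∀ {i j : Fin m} (k l : Fin m′) → combine i k F.< combine j l → i F.≤ j
combine-<⇒≤ˡ k l lt = ≮⇒≥ λ j<i → <-asym lt (combine-monoˡ-< l k j<i)

Decreasing : (ℕ → Bool) → Set
Decreasing f = ∀ t → f (suc t) ≡ true → f t ≡ true

decreasing-false : ∀ {f} → Decreasing f → f 0 ≡ false → ∀ t → f t ≡ false
decreasing-false dec f₀ zero = f₀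
decreasing-false {f} dec f₀ (suc t) with f (suc t) in fₜ
... | false = refl
... | true = contradiction (decreasing-false dec f₀ t) (≡true⇒≢false (dec t fₜ))

record Threshold (f : ℕ → Bool) (T : ℕ) : Set where
  constructor mkThreshold
  field
    at          : Fin (suc T)
    false-after : ∀ t → toℕ at ≤ t → f t ≡ false
    true-before : ∀ t → t ℕ.< toℕ at → f t ≡ true

threshold : ∀ {f} → Decreasing f → ∀ T → f T ≡ false → Threshold f T
threshold {f} dec T f_T with f 0 in f₀
... | false = mkThreshold F.zero (λ t _ → decreasing-false dec f₀ t) λ _ ()
threshold {f} dec zero f_T | true = contradiction f_T (≡true⇒≢false f₀)
threshold {f} dec (suc T) f_T | true
  with mkThreshold τ after before ← threshold {f ∘ suc} (dec ∘ suc) T f_T =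
  mkThreshold (F.suc τ) after′ before′
  where
  after′ : ∀ t → suc (toℕ τ) ≤ t → f t ≡ false
  after′ (suc t) (s≤s τ≤t) = after t τ≤t
  before′ : ∀ t → t ℕ.< suc (toℕ τ) → f t ≡ true
  before′ zero _ = f₀
  before′ (suc t) (s≤s t<τ) = before t t<τ

module _ (G : Graph) where

  boundary : (Fin (n G) → Bool) → Fin (n G) → Bool
  boundary P x = P x ∧ anyF (λ y → adj G x y ∧ not (P y))

  module _ {P : Fin (n G) → Bool} {x : Fin (n G)} where

    ∈boundary : ∀ {y} → P x ≡ true → adj G x y ≡ true → P y ≡ false → boundary P x ≡ true
    ∈boundary {y} Px xy Py = cong₂ _∧_ Px (∃⇒anyF _ y (cong₂ _∧_ xy (cong not Py)))

    boundary⇒ : boundary P x ≡ true → P x ≡ true × ∃ λ y → adj G x y ≡ true × P y ≡ false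
    boundary⇒ ∂x with y , yOut ← anyF⇒∃ _ (∧-conicalʳ (P x) _ ∂x) =
      ∧-conicalˡ (P x) _ ∂x , y ,
      ∧-conicalˡ (adj G x y) _ yOut , not-injective (∧-conicalʳ (adj G x y) _ yOut)

prefix : ∀ {r} → (Fin m → Fin r) → Fin r → Fin m → Bool
prefix key i x = ⌊ key x <? i ⌋

module Layout {G : Graph} {r : ℕ} (key : Fin (n G) → Fin r) where

  layoutBag : Fin r → Fin (n G) → Bool
  layoutBag i x = (key x == i) ∨ boundary G (prefix key i) x

  private
    variable
      i j l : Fin r
      x y : Fin (n G)

  ∈bag-key : key x ≡ i → layoutBag i x ≡ true
  ∈bag-key {x} refl = cong (_∨ boundary G (prefix key (key x)) x) (≡⇒== refl)

  ∈bag-boundary : key x F.< i → adj G x y ≡ true → i F.≤ key y → layoutBag i x ≡ true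
  ∈bag-boundary {x} {i} {y} x<i xy i≤y = trans (cong ((key x == i) ∨_) ∂x) (∨-zeroʳ _)
    where
    ∂x : boundary G (prefix key i) x ≡ true
    ∂x = ∈boundary G (⌊⌋-true (key x <? i) x<i) xy (⌊⌋-false (key y <? i) (≤⇒≯ i≤y))

  bag⇒ : layoutBag i x ≡ true →
    key x ≡ i ⊎ (key x F.< i × ∃ λ y → adj G x y ≡ true × i F.≤ key y)
  bag⇒ {i} {x} x∈i with ∨⇒⊎ (key x == i) x∈i
  ... | inj₁ x=i = inj₁ (==⇒≡ x=i)
  ... | inj₂ ∂x with x<i , y , xy , y≮i ← boundary⇒ G ∂x =
    inj₂ (⌊⌋-true⁻ (key x <? i) x<i , y , xy , ≮⇒≥ (⌊⌋-false⁻ (key y <? i) y≮i))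

  bag⇒key≤ : layoutBag i x ≡ true → key x F.≤ i
  bag⇒key≤ x∈i with bag⇒ x∈i
  ... | inj₁ refl = ≤-refl
  ... | inj₂ (x<i , _) = <⇒≤ x<i

  bag-interval : i F.≤ j → j F.≤ l →
    layoutBag i x ≡ true → layoutBag l x ≡ true → layoutBag j x ≡ true
  bag-interval i≤j j≤l x∈i x∈l with m≤n⇒m<n∨m≡n (≤-trans (bag⇒key≤ x∈i) i≤j) | bag⇒ x∈l
  ... | inj₂ x=j | _ = ∈bag-key (toℕ-injective x=j)
  ... | inj₁ x<j | inj₁ refl = contradiction x<j (≤⇒≯ j≤l)
  ... | inj₁ x<j | inj₂ (_ , y , xy , l≤y) = ∈bag-boundary x<j xy (≤-trans j≤l l≤y)

  edge∈bag : key x F.≤ key y → adj G x y ≡ true → layoutBag (key y) x ≡ true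
  edge∈bag x≤y xy with m≤n⇒m<n∨m≡n x≤y
  ... | inj₁ x<y = ∈bag-boundary x<y xy ≤-refl
  ... | inj₂ x=y = ∈bag-key (toℕ-injective x=y)

  layoutDecomposition : PathDecomposition G
  layoutDecomposition = record
    { r = r
    ; bag = layoutBag
    ; covV = λ x → key x , ∈bag-key refl
    ; covE = edge∈someBag
    ; interval = λ i j l x → bag-interval {i} {j} {l} {x}
    }
    where
    edge∈someBag : ∀ x y → adj G x y ≡ true →
      ∃ λ i → layoutBag i x ≡ true × layoutBag i y ≡ true
    edge∈someBag x y xy with key x F.≤? key y
    ... | yes x≤y = key y , edge∈bag x≤y xy , ∈bag-key refl
    ... | no x≰y = key x , ∈bag-key refl , edge∈bag (<⇒≤ (≰⇒> x≰y)) (trans (Graph.sym G y x) xy)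

vertexSeparation⇒pathwidth : ∀ {G r} k (key : Fin (n G) → Fin r) → Injective _≡_ _≡_ key →
  (∀ i → count (boundary G (prefix key i)) ≤ k) → PathwidthAtMost G k
vertexSeparation⇒pathwidth {G} k key injective separation = layoutDecomposition , width
  where
  open Layout key
  width : ∀ i → count (layoutBag i) ≤ suc k
  width i = ≤-trans (count-∨ (λ x → key x == i) (boundary G (prefix key i)))
    (+-mono-≤ (count-≤1 _ λ x=i y=i → injective (trans (==⇒≡ x=i) (sym (==⇒≡ y=i))))
              (separation i))

module Lions {G : Graph} {k : ℕ} (S : LionStrategy G k) where

  private
    variable
      t : ℕ
      x y : Fin (n G)

  lion-at : inL S t x ≡ true → ∃ λ i → pos S t i ≡ x
  lion-at here with i , i-at-x ← anyF⇒∃ _ here = i , ==⇒≡ i-at-x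

  lion⇒inL : ∀ i → pos S t i ≡ x → inL S t x ≡ true
  lion⇒inL i i-at-x = ∃⇒anyF _ i (≡⇒== i-at-x)

  lion-crossed : inπ S t x y ≡ true → ∃ λ i → pos S t i ≡ x × pos S (suc t) i ≡ y
  lion-crossed {t} {x} {y} crossed with i , i-crosses ← anyF⇒∃ _ crossed =
    i , ==⇒≡ (∧-conicalˡ (pos S t i == x) _ i-crosses) ,
        ==⇒≡ (∧-conicalʳ (pos S t i == x) _ i-crosses)

  clean₀⇒guarded : W S 0 x ≡ false → inL S 0 x ≡ true
  clean₀⇒guarded = not-injective

  contaminated⇒unguarded : ∀ t → W S t x ≡ true → inL S t x ≡ false
  contaminated⇒unguarded zero Wx = not-injective Wx
  contaminated⇒unguarded (suc t) Wx = not-injective (∧-conicalˡ _ _ Wx)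

  recontamination-blocked : W S (suc t) x ≡ false → inL S (suc t) x ≡ false →
    W S t y ≡ true → adj G x y ≡ true → inπ S t x y ≡ true ⊎ inπ S t y x ≡ true
  recontamination-blocked {t} {x} {y} clean unguarded Wy xy
    with inπ S t x y in forth | inπ S t y x in back
  ... | true  | _    = inj₁ refl
  ... | false | true = inj₂ refl
  ... | false | false = contradiction clean (≡true⇒≢false recontaminated)
    where
    spreads : anyF (λ w → W S t w ∧ adj G x w ∧ not (inπ S t x w) ∧ not (inπ S t w x)) ≡ true
    spreads = ∃⇒anyF _ y
      (cong₂ _∧_ Wy (cong₂ _∧_ xy (cong₂ _∧_ (cong not forth) (cong not back))))
    recontaminated : W S (suc t) x ≡ true
    recontaminated = cong₂ _∧_ (cong not unguarded) (trans (cong (W S t x ∨_) spreads) (∨-zeroʳ _))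

  clean₀-boundary≤ : (P : Fin (n G) → Bool) → (∀ x → P x ≡ true → W S 0 x ≡ false) →
    count (boundary G P) ≤ k
  clean₀-boundary≤ P P⊆clean = covered⇒count≤ _ (pos S 0)
    λ x ∂x → lion-at (clean₀⇒guarded (P⊆clean x (proj₁ (boundary⇒ G ∂x))))

  sandwiched-boundary≤ : ∀ s (P : Fin (n G) → Bool) →
    (∀ x → W S s x ≡ false → P x ≡ true) → (∀ x → P x ≡ true → W S (suc s) x ≡ false) →
    count (boundary G P) ≤ k
  sandwiched-boundary≤ s P clean⊆P P⊆clean = covered⇒count≤ _ guard guarded
    where
    guard : Fin k → Fin (n G)
    guard i = if P (pos S (suc s) i) then pos S (suc s) i else pos S s i

    stays : ∀ {i} → pos S (suc s) i ≡ x → P x ≡ true → guard i ≡ x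
    stays i-at-x Px rewrite i-at-x | Px = refl

    leaves : ∀ {i} → pos S s i ≡ x → P (pos S (suc s) i) ≡ false → guard i ≡ x
    leaves i-at-x out rewrite out = i-at-x

    contaminated : P y ≡ false → W S s y ≡ true
    contaminated {y} Py with W S s y in Wy
    ... | true  = refl
    ... | false = contradiction Py (≡true⇒≢false (clean⊆P y Wy))

    guarded : ∀ x → boundary G P x ≡ true → ∃ λ i → guard i ≡ x
    guarded x ∂x with Px , y , xy , Py ← boundary⇒ G ∂x | inL S (suc s) x in guarded-now
    ... | true with i , i-at-x ← lion-at guarded-now = i , stays i-at-x Px
    ... | false with recontamination-blocked (P⊆clean x Px) guarded-now (contaminated Py) xy
    ...   | inj₁ forth with i , i-at-x , i-at-y ← lion-crossed forth =
      i , leaves i-at-x (subst (λ z → P z ≡ false) (sym i-at-y) Py)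
    ...   | inj₂ back with i , i-at-y , _ ← lion-crossed back =
      contradiction (contaminated⇒unguarded s (contaminated Py)) (≡true⇒≢false (lion⇒inL i i-at-y))

module ClearingOrder {G : Graph} {k : ℕ} (S : LionStrategy G k) (monotone : Monotone S)
                     (T : ℕ) (cleared : ∀ x → W S T x ≡ false) where

  open Lions S

  clearing : ∀ x → Threshold (λ t → W S t x) T
  clearing x = threshold (λ t → monotone t x) T (cleared x)

  open Threshold

  clearingTime : Fin (n G) → Fin (suc T)
  clearingTime x = at (clearing x)

  -- combine enumerates Fin (suc T) × Fin n lexicographically: vertices are ordered by clearing
  -- time, ties broken by index.
  clearingOrder : Fin (n G) → Fin (suc T ℕ.* n G)
  clearingOrder x = combine (clearingTime x) x

  clearingOrder-injective : Injective _≡_ _≡_ clearingOrder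
  clearingOrder-injective {x} {y} = combine-injectiveʳ (clearingTime x) x (clearingTime y) y

  prefix⊆clean : ∀ t j x → prefix clearingOrder (combine t j) x ≡ true → W S (toℕ t) x ≡ false
  prefix⊆clean t j x x<tj = false-after (clearing x) (toℕ t)
    (combine-<⇒≤ˡ x j (⌊⌋-true⁻ (clearingOrder x <? combine t j) x<tj))

  clean⊆prefix : ∀ s j x → W S (toℕ s) x ≡ false →
    prefix clearingOrder (combine (F.suc s) j) x ≡ true
  clean⊆prefix s j x clean = ⌊⌋-true (clearingOrder x <? combine (F.suc s) j)
    (combine-monoˡ-< x j (s≤s (≮⇒≥ λ s<τ →
      contradiction clean (≡true⇒≢false (true-before (clearing x) (toℕ s) s<τ)))))

  clearingOrder-separation : ∀ i → count (boundary G (prefix clearingOrder i)) ≤ k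
  clearingOrder-separation i with combine-surjective {suc T} {n G} i
  ... | F.zero  , j , refl = clean₀-boundary≤ _ (prefix⊆clean F.zero j)
  ... | F.suc s , j , refl =
    sandwiched-boundary≤ (toℕ s) _ (clean⊆prefix s j) (prefix⊆clean (F.suc s) j)

theorem25 : (G : Graph) (k : ℕ) → 1 ≤ k → (S : LionStrategy G k) →
    Monotone S → Clears S → PathwidthAtMost G k
theorem25 G k _ S monotone (T , cleared) =
  vertexSeparation⇒pathwidth k clearingOrder clearingOrder-injective clearingOrder-separation
  where open ClearingOrder S monotone T cleared
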